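{- Let $n\in\mathbb{N}$. For all formulas $A_1,\dots,A_n,A_{n+1},B$: (1) $\vDash ((A_1,\dots,A_n)\vartriangleleft^n B)\to((A_1,\dots,A_{n+1})\vartriangleleft^{n+1}B)$; (2) $\vDash ((A_1,\dots,A_n)\vartriangleleft^n A_{n+1})\to\big(((A_1,\dots,A_{n+1})\vartriangleleft^{n+1}B)\leftrightarrow((A_1,\dots,A_n)\vartriangleleft^n B)\big)$.
   Context: Models are $\mathcal{M}=\langle W,S,V\rangle$ with $W$ nonempty, $S\subseteq W^3$ arbitrary (written $S_wuv$), $V$ a valuation. For each $n\in\mathbb{N}$, $\vartriangleleft^n$ is an $(n+1)$-ary operator with $\mathcal{M},w\vDash(A_1,\dots,A_n)\vartriangleleft^n B$ iff for all $u,v\in W$ with $S_wuv$, if ($\mathcal{M},u\vDash A_i\iff\mathcal{M},v\vDash A_i$) for all $i\in\{1,\dots,n\}$, then ($\mathcal{M},u\vDash B\iff\mathcal{M},v\vDash B$). Formulas are built from proposition symbols with $\neg,\land$ and these operators; Boolean and atomic clauses as usual. $\vDash$ denotes truth at every world of every model. -}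

module Defs where

open import Data.Nat using (ℕ; zero; suc)
open import Data.Vec using (Vec; []; _∷_; _∷ʳ_)
open import Data.Product using (_×_; _,_)
open import Data.Empty using (⊥)
open import Data.Unit using (⊤)
open import Function.Bundles using (_⇔_)
open import Level using (Level; _⊔_; suc)

-- Formulas: proposition symbols (indexed by ℕ), ¬, ∧, and for each n the
-- (n+1)-ary operator (A₁,…,Aₙ) ◁ⁿ B, written  ◁ n As B.
data Formula : Set where
  var : ℕ → Formula
  ¬ₚ  : Formula → Formula
  _∧ₚ_ : Formula → Formula → Formula
  ◁ : (n : ℕ) → Vec Formula n → Formula → Formula

_→ₚ_ : Formula → Formula → Formula
A →ₚ B = ¬ₚ (A ∧ₚ ¬ₚ B)

_↔ₚ_ : Formula → Formula → Formula
A ↔ₚ B = (A →ₚ B) ∧ₚ (B →ₚ A)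

record Model (a b : Level) : Set (Level.suc (a ⊔ b)) where
  field
    W : Set a
    w₀ : W                        -- W is nonempty
    S : W → W → W → Set b
    V : ℕ → W → Set b

module _ {a b : Level} (M : Model a b) where
  open Model M

  mutual
    sat : W → Formula → Set (a ⊔ b)
    sat w (var p) = Level.Lift a (V p w)
    sat w (¬ₚ A) = sat w A → ⊥
    sat w (A ∧ₚ B) = sat w A × sat w B
    sat w (◁ n As B) =
      (u v : W) → S w u v → agreeAll u v As → (sat u B ⇔ sat v B)

    agreeAll : W → W → {n : ℕ} → Vec Formula n → Set (a ⊔ b)
    agreeAll u v [] = Level.Lift _ ⊤
    agreeAll u v (A ∷ As) = (sat u A ⇔ sat v A) × agreeAll u v As

Valid : (a b : Level) → Formula → Set (Level.suc (a ⊔ b))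
Valid a b A = (M : Model a b) → (w : Model.W M) → sat M w A

module Submission where

open import Defs
open import Data.Nat using (ℕ; suc)
open import Data.Vec using (Vec; _∷ʳ_; []; _∷_)
open import Data.Product using (_×_; _,_)
open import Level using (Level)
open import Function.Bundles using (_⇔_)

-- Appending A′ strengthens the agreement premise of ◁, so ◁ⁿ B gives ◁ⁿ⁺¹ B.
-- If moreover ◁ⁿ A′ holds, agreement on As already forces agreement on A′ at
-- every S-related pair, so the extra premise is redundant and the converse holds.

module _ {a b : Level} (M : Model a b) where
  open Model M

  agreeAll-init : (u v : W) {n : ℕ} (As : Vec Formula n) (A′ : Formula) →
    agreeAll M u v (As ∷ʳ A′) → agreeAll M u v As
  agreeAll-init u v []       A′ _         = Level.lift _
  agreeAll-init u v (A ∷ As) A′ (eq , ag) = eq , agreeAll-init u v As A′ ag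

  agreeAll-snoc : (u v : W) {n : ℕ} (As : Vec Formula n) (A′ : Formula) →
    agreeAll M u v As → (sat M u A′ ⇔ sat M v A′) → agreeAll M u v (As ∷ʳ A′)
  agreeAll-snoc u v []       A′ _         eq′ = eq′ , Level.lift _
  agreeAll-snoc u v (A ∷ As) A′ (eq , ag) eq′ = eq , agreeAll-snoc u v As A′ ag eq′

  sat-◁-snoc : (w : W) {n : ℕ} (As : Vec Formula n) (A′ B : Formula) →
    sat M w (◁ n As B) → sat M w (◁ (suc n) (As ∷ʳ A′) B)
  sat-◁-snoc w As A′ B ◁B u v s ag = ◁B u v s (agreeAll-init u v As A′ ag)

  sat-◁-unsnoc : (w : W) {n : ℕ} (As : Vec Formula n) (A′ B : Formula) →
    sat M w (◁ n As A′) → sat M w (◁ (suc n) (As ∷ʳ A′) B) → sat M w (◁ n As B)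
  sat-◁-unsnoc w As A′ B ◁A′ ◁B u v s ag =
    ◁B u v s (agreeAll-snoc u v As A′ ag (◁A′ u v s ag))

  sat-→ₚ : (w : W) (A B : Formula) → (sat M w A → sat M w B) → sat M w (A →ₚ B)
  sat-→ₚ w A B f (x , ¬y) = ¬y (f x)

  sat-↔ₚ : (w : W) (A B : Formula) →
    (sat M w A → sat M w B) → (sat M w B → sat M w A) → sat M w (A ↔ₚ B)
  sat-↔ₚ w A B f g = sat-→ₚ w A B f , sat-→ₚ w B A g

proposition6p2 : {a b : Level} (n : ℕ) (As : Vec Formula n) (A′ B : Formula) →
    Valid a b (◁ n As B →ₚ ◁ (suc n) (As ∷ʳ A′) B)
    × Valid a b (◁ n As A′ →ₚ (◁ (suc n) (As ∷ʳ A′) B ↔ₚ ◁ n As B))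
proposition6p2 n As A′ B = monotone , redundant
  where
  ◁ⁿB ◁ⁿ⁺¹B ◁ⁿA′ : Formula
  ◁ⁿB   = ◁ n As B
  ◁ⁿ⁺¹B = ◁ (suc n) (As ∷ʳ A′) B
  ◁ⁿA′  = ◁ n As A′

  monotone : ∀ {a b} → Valid a b (◁ⁿB →ₚ ◁ⁿ⁺¹B)
  monotone M w = sat-→ₚ M w ◁ⁿB ◁ⁿ⁺¹B (sat-◁-snoc M w As A′ B)

  redundant : ∀ {a b} → Valid a b (◁ⁿA′ →ₚ (◁ⁿ⁺¹B ↔ₚ ◁ⁿB))
  redundant M w = sat-→ₚ M w ◁ⁿA′ (◁ⁿ⁺¹B ↔ₚ ◁ⁿB) λ ◁A′ →
    sat-↔ₚ M w ◁ⁿ⁺¹B ◁ⁿB (sat-◁-unsnoc M w As A′ B ◁A′) (sat-◁-snoc M w As A′ B)
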